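{- Let $D$ be a drawing of a graph satisfying the standing assumptions below. Then $D$ can be turned into a cased drawing (weaving model) without any switches if and only if the edge crossing graph $G_{DC}$ of $D$ is bipartite.
   Context: A drawing places vertices at distinct points and edges as straight segments; no vertex lies on an edge unless it is an endpoint of it, no more than two edges cross in one point, and crossings are far enough apart to be treated independently. A cased drawing in the weaving model chooses independently at each crossing of edges $e_1,e_2$ which is on top; the crossing is a bridge for the top edge and a tunnel for the other. A switch is a pair of consecutive crossings along an edge $e$ with one a bridge and the other a tunnel for $e$. The edge crossing graph $G_{DC}$ has a vertex for each edge of $D$ and an edge between two vertices whenever the corresponding edges of $D$ cross. -}

module Defs where

open import Data.Nat using (ℕ)
open import Data.Fin using (Fin)
open import Data.Bool using (Bool; not)
open import Data.List using (List; _∷_)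
open import Data.List.Membership.Propositional using (_∈_; _∉_)
open import Data.List.Relation.Unary.Unique.Propositional using (Unique)
open import Data.Product using (Σ; _×_)
open import Relation.Binary.PropositionalEquality using (_≡_; _≢_)
open import Relation.Nullary using (¬_)

-- Combinatorial data of a (straight-line) drawing D with m edges,
-- edges numbered by Fin m.  For each edge e, `order e` lists the edges
-- crossing e, in the order their crossings with e occur when walking
-- along the segment e (from one endpoint to the other).
-- Since edges are straight segments, two edges cross at most once, so
-- each crossing edge appears once; crossing is symmetric; no edge
-- crosses itself.
record Drawing (m : ℕ) : Set where
  field
    order     : Fin m → List (Fin m)
    unique    : ∀ e → Unique (order e)
    symmetric : ∀ e f → f ∈ order e → e ∈ order f
    irreflex  : ∀ e → e ∉ order e

open Drawing public

Cross : ∀ {m} → Drawing m → Fin m → Fin m → Set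
Cross D e f = f ∈ order D e

data Consecutive {A : Set} : List A → A → A → Set where
  here  : ∀ {x y xs} → Consecutive (x ∷ y ∷ xs) x y
  there : ∀ {z x y xs} → Consecutive xs x y → Consecutive (z ∷ xs) x y

-- A casing (weaving model): at each crossing of e and f, exactly one of
-- them is on top.  `above e f ≡ true` means e is on top at its crossing
-- with f, i.e. that crossing is a bridge for e (and a tunnel for f).
-- Values of `above` at non-crossing pairs are irrelevant.
record Casing {m : ℕ} (D : Drawing m) : Set where
  field
    above      : Fin m → Fin m → Bool
    consistent : ∀ e f → Cross D e f → above f e ≡ not (above e f)

open Casing public

Switch : ∀ {m} {D : Drawing m} → Casing D → Fin m → Fin m → Fin m → Set
Switch {D = D} C e f g =
  Consecutive (order D e) f g × above C e f ≢ above C e g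

SwitchFree : ∀ {m} {D : Drawing m} → Casing D → Set
SwitchFree C = ∀ e f g → ¬ Switch C e f g

Bipartite-GDC : ∀ {m} → Drawing m → Set
Bipartite-GDC {m} D =
  Σ (Fin m → Bool) λ col → ∀ e f → Cross D e f → col e ≢ col f

module Submission where

-- A casing of D is switch-free iff every edge e is uniformly on top or
-- uniformly below at all of its crossings, and such "uniform" casings are
-- exactly proper 2-colourings of the edge crossing graph G_DC.
--
-- (⇒) Switch-freeness says that `above C e` takes equal values on any two
--     consecutive crossings along e; a function that is constant across
--     consecutive list entries is constant on the whole list (a general fact
--     about lists, proved first).  Colour e by its value at its first
--     crossing.  If e and f cross, colour e = above e f and
--     colour f = above f e = not (above e f), so the colouring is proper.
-- (⇐) Given a proper colouring col, put e on top at a crossing with f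
--     exactly when col e = true.  Properness gives consistency
--     (col f = not (col e)), and since `above e` ignores its second argument
--     there are no switches.

open import Defs
open import Data.Nat using (ℕ)
open import Data.Fin using (Fin)
open import Data.Bool using (Bool; false; not)
open import Data.Bool.Properties using (_≟_; not-¬; ¬-not)
open import Data.List using (List; []; _∷_)
open import Data.List.Relation.Unary.Any using (here; there)
open import Data.List.Membership.Propositional using (_∈_)
open import Data.Product using (Σ; _,_)
open import Function.Bundles using (_⇔_; mk⇔)
open import Relation.Binary.PropositionalEquality using (_≡_; _≢_; refl; sym; trans; module ≡-Reasoning)
open import Relation.Nullary using (yes; no; contradiction)

module _ {A B : Set} (p : A → B) where

  LocallyConstant : List A → Set
  LocallyConstant xs = ∀ {x y} → Consecutive xs x y → p x ≡ p y

  locallyConstant⇒constant : ∀ {x xs} → LocallyConstant (x ∷ xs) →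
                             ∀ {y} → y ∈ x ∷ xs → p y ≡ p x
  locallyConstant⇒constant lc (here refl) = refl
  locallyConstant⇒constant {xs = z ∷ zs} lc (there y∈) =
    trans (locallyConstant⇒constant (λ c → lc (there c)) y∈) (sym (lc here))

atHead : {A B : Set} → B → (A → B) → List A → B
atHead b p []      = b
atHead b p (x ∷ _) = p x

locallyConstant⇒atHead : {A B : Set} (b : B) (p : A → B) {xs : List A} →
                         LocallyConstant p xs →
                         ∀ {y} → y ∈ xs → p y ≡ atHead b p xs
locallyConstant⇒atHead b p {x ∷ xs} lc y∈ = locallyConstant⇒constant p lc y∈

module _ {m : ℕ} {D : Drawing m} (C : Casing D) where

  switchFree⇒locallyConstant : SwitchFree C → ∀ e →
                               LocallyConstant (above C e) (order D e)
  switchFree⇒locallyConstant sf e {f} {g} c with above C e f ≟ above C e g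
  ... | yes same = same
  ... | no differ = contradiction (c , differ) (sf e f g)

  onTopFirst : Fin m → Bool
  onTopFirst e = atHead false (above C e) (order D e)

  switchFree⇒uniform : SwitchFree C → ∀ {e f} → Cross D e f →
                       above C e f ≡ onTopFirst e
  switchFree⇒uniform sf {e} =
    locallyConstant⇒atHead false (above C e) (switchFree⇒locallyConstant sf e)

  switchFree⇒bipartite : SwitchFree C → Bipartite-GDC D
  switchFree⇒bipartite sf = onTopFirst , proper
    where
    proper : ∀ e f → Cross D e f → onTopFirst e ≢ onTopFirst f
    proper e f cr same = not-¬ refl selfDual
      where
      open ≡-Reasoning
      selfDual : above C e f ≡ not (above C e f)
      selfDual = begin
        above C e f  ≡⟨ switchFree⇒uniform sf cr ⟩
        onTopFirst e ≡⟨ same ⟩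
        onTopFirst f ≡⟨ switchFree⇒uniform sf (symmetric D e f cr) ⟨
        above C f e  ≡⟨ consistent C e f cr ⟩
        not (above C e f) ∎

bipartite⇒switchFree : ∀ {m} {D : Drawing m} →
                       Bipartite-GDC D → Σ (Casing D) SwitchFree
bipartite⇒switchFree {D = D} (col , proper) = casing , λ e f g (_ , differ) → differ refl
  where
  casing : Casing D
  casing = record { above      = λ e _ → col e
                  ; consistent = λ e f cr → ¬-not (λ eq → proper e f cr (sym eq)) }

lemma1 : (m : ℕ) (D : Drawing m) →
    (Σ (Casing D) SwitchFree) ⇔ Bipartite-GDC D
lemma1 m D = mk⇔ (λ (C , sf) → switchFree⇒bipartite C sf) bipartite⇒switchFree
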